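{- Let $A$ be a nontrivial closed class of decision tables from $\mathcal{M}_2^{\infty}$ and let $\psi$ be a bounded complexity measure. If the function $G_{\psi,A}$ is not everywhere defined, then the function $\mathcal{H}^{\infty}_{\psi,A}$ is not everywhere defined.
   Context: Let $\omega=\{0,1,2,\ldots\}$, let $\mathcal{P}(\omega)$ be the set of nonempty finite subsets of $\omega$, and $E_2=\{0,1\}$. Let $P=\{f_i:i\in\omega\}$ be a set of attributes ($f_i\neq f_j$ iff $i\neq j$). $\mathcal{M}_2^{\infty}$ is the set of rectangular tables filled with numbers from $E_2$ whose rows are pairwise different, each row labeled with a set from $\mathcal{P}(\omega)$ (its set of decisions), and whose columns are labeled with pairwise different attributes from $P$; tables with no rows, all denoted $\Lambda$, also belong to $\mathcal{M}_2^{\infty}$. For $T\in\mathcal{M}_2^\infty$: $\Delta(T)$ is its set of rows, $\operatorname{At}(T)$ its set of column attributes, $\Pi(T)$ the intersection of the decision sets of all rows. For nonempty $T$, $\Omega_2(T)$ is the set of finite words (including the empty word $\lambda$) over the alphabet $\{(f_i,\delta):f_i\in\operatorname{At}(T),\delta\in E_2\}$; for $\alpha=(f_{i_1},\delta_1)\cdots(f_{i_m},\delta_m)$, $T\alpha$ is the subtable of rows having $\delta_1,\ldots,\delta_m$ in the columns labeled $f_{i_1},\ldots,f_{i_m}$ respectively ($T\lambda=T$). Operations: for $D\subseteq\operatorname{At}(T)$, $I(D,T)$ is obtained by deleting the columns labeled by attributes in $D$ and, in each group of rows equal on the remaining columns, keeping only the first one; for $\nu:E_2^{|\operatorname{At}(T)|}\to\mathcal{P}(\omega)$,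 $J(\nu,T)$ replaces the decision set of each row $\bar\delta$ by $\nu(\bar\delta)$. $[T]=\{J(\nu,I(D,T)):D\subseteq\operatorname{At}(T),\nu:E_2^{|\operatorname{At}(T)\setminus D|}\to\mathcal{P}(\omega)\}$, $[A]=\bigcup_{T\in A}[T]$; $A$ is a closed class if $[A]=A$, nontrivial if it contains a nonempty table. Decision trees: a $2$-decision tree is a finite directed rooted tree with at least two nodes, where the root and edges leaving it are unlabeled, terminal nodes are labeled with decisions from $\omega$, and every other node is labeled with an attribute from $P$, each edge leaving it labeled with a number from $E_2$. $\operatorname{At}(\Gamma)$ is the set of attributes labeling its nodes. For a complete path $\tau=v_1,d_1,\ldots,v_m,d_m,v_{m+1}$ (root to a terminal node), $\pi(\tau)=\lambda$ if $m=1$, otherwise $\pi(\tau)=(f_{i_2},\delta_2)\cdots(f_{i_m},\delta_m)$ where $v_j$ is labeled $f_{i_j}$ and $d_j$ is labeled $\delta_j$; $T(\tau)=T\pi(\tau)$. For nonempty $T$, a nondeterministic decision tree for $T$ is a $2$-decision tree $\Gamma$ with $\operatorname{At}(\Gamma)\subseteq\operatorname{At}(T)$ such that each row of $T$ belongs to $T(\tau)$ for some complete path $\tau$, and for each complete path $\tau$ either $T(\tau)=\Lambda$ or the decision at its terminal node lies in $\Pi(T(\tau))$. A deterministic decision tree for $T$ is a nondeterministic one in which exactly one edge leaves the root and edges leaving any other nonterminal node have pairwise different labels. Complexity measures: $P^*$ is the set of finite words over $P$ (including $\lambda$). A partially bounded complexity measure is $\psi:P^*\to\omega$ with: $\psi(\alpha)=0$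 iff $\alpha=\lambda$; $\psi$ invariant under permutation of letters; $\psi(\alpha_1)\le\psi(\alpha_1\alpha_2)$; $\psi(\alpha_1\alpha_2)\le\psi(\alpha_1)+\psi(\alpha_2)$. It is bounded if also $\psi(\alpha)\ge|\alpha|$ for all $\alpha$. Extend $\psi$ to words over pairs by $\psi((f_{i_1},\delta_1)\cdots(f_{i_m},\delta_m))=\psi(f_{i_1}\cdots f_{i_m})$, $\psi(\lambda)=0$, and to trees by $\psi(\Gamma)=\max_\tau\psi(\pi(\tau))$ over complete paths. For nonempty $T$, $\psi^d(T)$ ($\psi^a(T)$) is the minimum of $\psi(\Gamma)$ over deterministic (nondeterministic) decision trees for $T$; $\psi^d(\Lambda)=\psi^a(\Lambda)=0$. A word $\alpha\in\Omega_2(T)$ is annihilating for $T$ if $T\alpha=\Lambda$ and $\alpha$ contains no two letters $(f_i,\delta),(f_i,\sigma)$ with $\delta\neq\sigma$; it is irreducible if no word obtained from $\alpha$ by deleting some letters and different from $\alpha$ is annihilating. $G(T)$ is the maximum length of an irreducible annihilating word for $T$, or $0$ if none exists; $G(\Lambda)=0$. $m_\psi(T)=\max\{\psi(f_i):f_i\in\operatorname{At}(T)\}$, $m_\psi(\Lambda)=0$; $A_\psi(n)=\{T\in A:m_\psi(T)\le n\}$. $G_{\psi,A}(n)$ is undefined if $\{G(T):T\in A_\psi(n)\}$ is infinite and equals its maximum otherwise. $\mathcal{H}^{\infty}_{\psi,A}(n)$ is undefined if $\{\psi^d(T):T\in A,\psi^a(T)\le n\}$ is infinite and equals its maximum otherwise.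 -}

module Defs where

open import Data.Nat using (ℕ; zero; suc; _≤_; _+_; _⊔_; _≡ᵇ_)
open import Data.Bool using (Bool; true; false; _∧_; if_then_else_; not)
open import Data.Maybe using (Maybe; just; nothing)
open import Data.List using (List; []; _∷_; _++_; map; length; foldr; filterᵇ)
open import Data.Vec using (Vec; []; _∷_; toList)
open import Data.Product using (Σ; ∃; ∃₂; _×_; _,_; proj₁; proj₂)
open import Data.Sum using (_⊎_)
open import Data.Empty using (⊥)
open import Data.Unit using (⊤)
open import Relation.Nullary using (¬_)
open import Relation.Binary.PropositionalEquality using (_≡_; _≢_)
open import Data.List.Membership.Propositional using (_∈_)
import Data.Vec.Membership.Propositional as VM
open import Data.List.Relation.Unary.All using (All)
open import Data.List.Relation.Unary.AllPairs using (AllPairs)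
open import Data.List.Relation.Unary.Linked using (Linked)
open import Data.List.Relation.Binary.Sublist.Propositional using (_⊆_)
open import Data.List.Relation.Binary.Permutation.Propositional using (_↭_)
import Data.Nat as N

-- Decision sets: nonempty finite subsets of ω, in canonical form
-- (strictly increasing nonempty lists of naturals).

DecSet : Set
DecSet = List ℕ

CanonicalDecSet : DecSet → Set
CanonicalDecSet s = (s ≢ []) × Linked N._<_ s

-- Tables.  Attribute f_i is represented by the natural number i.
-- E_2 = {0,1} is represented by Bool (false = 0, true = 1).
-- A row is a vector of values together with its set of decisions.

Row : ℕ → Set
Row n = Vec Bool n × DecSet

record Table : Set where
  constructor mkTable
  field
    ncols : ℕ
    attrs : Vec ℕ ncols
    rows  : List (Row ncols)
open Table public

WellFormed : Table → Set
WellFormed T =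
  AllPairs _≢_ (toList (attrs T)) ×
  AllPairs (λ r s → proj₁ r ≢ proj₁ s) (rows T) ×
  All (λ r → CanonicalDecSet (proj₂ r)) (rows T)

IsEmpty : Table → Set
IsEmpty T = rows T ≡ []

beq : Bool → Bool → Bool
beq true  b = b
beq false b = not b

veq : ∀ {n} → Vec Bool n → Vec Bool n → Bool
veq [] [] = true
veq (x ∷ xs) (y ∷ ys) = beq x y ∧ veq xs ys

velem : ∀ {n} → Vec Bool n → List (Vec Bool n) → Bool
velem v [] = false
velem v (w ∷ ws) = if veq v w then true else velem v ws

-- Operation I(D,T).  D ⊆ At(T) is given as a mask on the columns
-- (true = the column is deleted).

countKeep : ∀ {n} → Vec Bool n → ℕ
countKeep [] = zero
countKeep (true  ∷ m) = countKeep m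
countKeep (false ∷ m) = suc (countKeep m)

project : ∀ {A : Set} {n} (m : Vec Bool n) → Vec A n → Vec A (countKeep m)
project [] [] = []
project (true  ∷ m) (x ∷ xs) = project m xs
project (false ∷ m) (x ∷ xs) = x ∷ project m xs

dedupFrom : ∀ {k} → List (Vec Bool k) → List (Row k) → List (Row k)
dedupFrom seen [] = []
dedupFrom seen (r ∷ rs) =
  if velem (proj₁ r) seen
  then dedupFrom seen rs
  else r ∷ dedupFrom (proj₁ r ∷ seen) rs

opI : (T : Table) → Vec Bool (ncols T) → Table
opI T D = mkTable (countKeep D) (project D (attrs T))
  (dedupFrom [] (map (λ r → project D (proj₁ r) , proj₂ r) (rows T)))

opJ : (T : Table) → (Vec Bool (ncols T) → DecSet) → Table
opJ T ν = mkTable (ncols T) (attrs T) (map (λ r → proj₁ r , ν (proj₁ r)) (rows T))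

CanonicalMap : ∀ {k} → (Vec Bool k → DecSet) → Set
CanonicalMap ν = ∀ v → CanonicalDecSet (ν v)

InClosureOf : Table → Table → Set
InClosureOf T T' =
  Σ (Vec Bool (ncols T)) λ D →
  Σ (Vec Bool (countKeep D) → DecSet) λ ν →
  CanonicalMap ν × (T' ≡ opJ (opI T D) ν)

InClosure : (Table → Set) → Table → Set
InClosure A T' = Σ Table λ T → A T × InClosureOf T T'

IsClass : (Table → Set) → Set
IsClass A = ∀ T → A T → WellFormed T

Closed : (Table → Set) → Set
Closed A = (∀ T → InClosure A T → A T) × (∀ T → A T → InClosure A T)

Nontrivial : (Table → Set) → Set
Nontrivial A = Σ Table λ T → A T × ¬ IsEmpty T

Word : Set
Word = List (ℕ × Bool)

valueAt : ∀ {n} → Vec ℕ n → Vec Bool n → ℕ → Maybe Bool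
valueAt [] [] i = nothing
valueAt (a ∷ as) (x ∷ xs) i = if a ≡ᵇ i then just x else valueAt as xs i

satLetter : ∀ {n} → Vec ℕ n → Vec Bool n → ℕ × Bool → Bool
satLetter as v (i , b) with valueAt as v i
... | just x  = beq b x
... | nothing = false

satWord : ∀ {n} → Vec ℕ n → Vec Bool n → Word → Bool
satWord as v [] = true
satWord as v (l ∷ α) = satLetter as v l ∧ satWord as v α

sub : Table → Word → Table
sub T α = mkTable (ncols T) (attrs T) (filterᵇ (λ r → satWord (attrs T) (proj₁ r) α) (rows T))

InΩ : Table → Word → Set
InΩ T α = All (λ l → proj₁ l VM.∈ attrs T) α

InΠ : ℕ → Table → Set
InΠ d T = All (λ r → d ∈ proj₂ r) (rows T)

NoConflict : Word → Set
NoConflict α = ∀ i δ σ → (i , δ) ∈ α → (i , σ) ∈ α → δ ≡ σ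

Annihilating : Table → Word → Set
Annihilating T α = InΩ T α × IsEmpty (sub T α) × NoConflict α

IrreducibleAnnihilating : Table → Word → Set
IrreducibleAnnihilating T α =
  Annihilating T α × (∀ β → β ⊆ α → β ≢ α → ¬ Annihilating T β)

IsG : Table → ℕ → Set
IsG T g =
  (IsEmpty T × g ≡ 0) ⊎
  (¬ IsEmpty T ×
    (((∀ α → ¬ IrreducibleAnnihilating T α) × g ≡ 0) ⊎
     ((Σ Word λ α → IrreducibleAnnihilating T α × length α ≡ g) ×
      (∀ α → IrreducibleAnnihilating T α → length α ≤ g))))

-- A non-root node is either terminal (labelled by a decision) or labelled
-- by an attribute with a nonempty list of outgoing edges labelled in E_2.
-- A tree is given by the nonempty list of nodes reached from the root.

mutual
  data Node : Set where
    leaf  : ℕ → Node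
    query : ℕ → Edges → Node

  data Edges : Set where
    lastE : Bool → Node → Edges
    consE : Bool → Node → Edges → Edges

data Tree : Set where
  lastR : Node → Tree
  consR : Node → Tree → Tree

data EdgeIn (b : Bool) (v : Node) : Edges → Set where
  hereL  : EdgeIn b v (lastE b v)
  hereC  : ∀ {es} → EdgeIn b v (consE b v es)
  thereC : ∀ {b' v' es} → EdgeIn b v es → EdgeIn b v (consE b' v' es)

data ChildOfRoot (v : Node) : Tree → Set where
  hereL  : ChildOfRoot v (lastR v)
  hereC  : ∀ {t} → ChildOfRoot v (consR v t)
  thereC : ∀ {v' t} → ChildOfRoot v t → ChildOfRoot v (consR v' t)

data NodePath : Node → Word → ℕ → Set where
  leafP  : ∀ {d} → NodePath (leaf d) [] d
  queryP : ∀ {i es b v w d} → EdgeIn b v es → NodePath v w d →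
           NodePath (query i es) ((i , b) ∷ w) d

-- complete paths τ of Γ, given by π(τ) and the decision at the terminal node
Path : Tree → Word → ℕ → Set
Path Γ w d = Σ Node λ v → ChildOfRoot v Γ × NodePath v w d

mutual
  NodeAttrsIn : ∀ {n} → Vec ℕ n → Node → Set
  NodeAttrsIn S (leaf d) = ⊤
  NodeAttrsIn S (query i es) = (i VM.∈ S) × EdgesAttrsIn S es

  EdgesAttrsIn : ∀ {n} → Vec ℕ n → Edges → Set
  EdgesAttrsIn S (lastE b v) = NodeAttrsIn S v
  EdgesAttrsIn S (consE b v es) = NodeAttrsIn S v × EdgesAttrsIn S es

TreeAttrsIn : ∀ {n} → Vec ℕ n → Tree → Set
TreeAttrsIn S (lastR v) = NodeAttrsIn S v
TreeAttrsIn S (consR v t) = NodeAttrsIn S v × TreeAttrsIn S t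

edgeLabels : Edges → List Bool
edgeLabels (lastE b v) = b ∷ []
edgeLabels (consE b v es) = b ∷ edgeLabels es

mutual
  DetNode : Node → Set
  DetNode (leaf d) = ⊤
  DetNode (query i es) = AllPairs _≢_ (edgeLabels es) × DetEdges es

  DetEdges : Edges → Set
  DetEdges (lastE b v) = DetNode v
  DetEdges (consE b v es) = DetNode v × DetEdges es

-- exactly one edge leaves the root
Deterministic : Tree → Set
Deterministic (lastR v) = DetNode v
Deterministic (consR v t) = ⊥

NondetTreeFor : Table → Tree → Set
NondetTreeFor T Γ =
  TreeAttrsIn (attrs T) Γ ×
  (∀ r → r ∈ rows T → Σ Word λ w → Σ ℕ λ d → Path Γ w d × r ∈ rows (sub T w)) ×
  (∀ w d → Path Γ w d → IsEmpty (sub T w) ⊎ InΠ d (sub T w))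

DetTreeFor : Table → Tree → Set
DetTreeFor T Γ = NondetTreeFor T Γ × Deterministic Γ

record BoundedComplexityMeasure (ψ : List ℕ → ℕ) : Set where
  field
    zero⇒empty : ∀ α → ψ α ≡ 0 → α ≡ []
    empty⇒zero : ψ [] ≡ 0
    perm-inv   : ∀ α β → α ↭ β → ψ α ≡ ψ β
    monotone   : ∀ α β → ψ α ≤ ψ (α ++ β)
    subadd     : ∀ α β → ψ (α ++ β) ≤ ψ α + ψ β
    bounded    : ∀ α → length α ≤ ψ α

-- ψ(Γ) = max over complete paths τ of ψ(π(τ)); the accumulator holds
-- the attributes of π read so far (in order from the root)
mutual
  nodeCost : (List ℕ → ℕ) → List ℕ → Node → ℕ
  nodeCost ψ acc (leaf d) = ψ acc
  nodeCost ψ acc (query i es) = edgesCost ψ (acc ++ (i ∷ [])) es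

  edgesCost : (List ℕ → ℕ) → List ℕ → Edges → ℕ
  edgesCost ψ acc (lastE b v) = nodeCost ψ acc v
  edgesCost ψ acc (consE b v es) = nodeCost ψ acc v ⊔ edgesCost ψ acc es

treeCost : (List ℕ → ℕ) → Tree → ℕ
treeCost ψ (lastR v) = nodeCost ψ [] v
treeCost ψ (consR v t) = nodeCost ψ [] v ⊔ treeCost ψ t

IsPsiD : (List ℕ → ℕ) → Table → ℕ → Set
IsPsiD ψ T k =
  (IsEmpty T × k ≡ 0) ⊎
  (¬ IsEmpty T ×
    (Σ Tree λ Γ → DetTreeFor T Γ × treeCost ψ Γ ≡ k) ×
    (∀ Γ → DetTreeFor T Γ → k ≤ treeCost ψ Γ))

IsPsiA : (List ℕ → ℕ) → Table → ℕ → Set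
IsPsiA ψ T k =
  (IsEmpty T × k ≡ 0) ⊎
  (¬ IsEmpty T ×
    (Σ Tree λ Γ → NondetTreeFor T Γ × treeCost ψ Γ ≡ k) ×
    (∀ Γ → NondetTreeFor T Γ → k ≤ treeCost ψ Γ))

mψ : (List ℕ → ℕ) → Table → ℕ
mψ ψ (mkTable n as []) = 0
mψ ψ (mkTable n as (r ∷ rs)) = foldr _⊔_ 0 (map (λ i → ψ (i ∷ [])) (toList as))

-- A set S ⊆ ω is infinite  (equivalently: unbounded)
InfiniteSet : (ℕ → Set) → Set
InfiniteSet S = ∀ m → Σ ℕ λ k → S k × m ≤ k

GUndefined : (List ℕ → ℕ) → (Table → Set) → ℕ → Set
GUndefined ψ A n =
  InfiniteSet (λ g → Σ Table λ T → (A T × mψ ψ T ≤ n) × IsG T g)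

HUndefined : (List ℕ → ℕ) → (Table → Set) → ℕ → Set
HUndefined ψ A n =
  InfiniteSet (λ k → Σ Table λ T → A T × (Σ ℕ λ j → IsPsiA ψ T j × j ≤ n) × IsPsiD ψ T k)

{-# OPTIONS --safe #-}
-- Take T ∈ A with mψ(T) ≤ n and an irreducible annihilating word α of length m + 1 > n. Deleting
-- the columns outside α and labelling each row by the positions of the letters of α it violates
-- gives a table T′ ∈ A, and by irreducibility, for every position p some row violates α_p only,
-- so its decision set is {p}. Guessing the violated letter shows ψᵃ(T′) = max_p ψ(a_p) ≤ n: a
-- path reaching the row for p without querying a_p must query all other attributes of α, which
-- already costs at least m ≥ n. A deterministic tree, however, has a path querying all attributes
-- of α but one, so ψᵈ(T′) = min_p ψ(α without a_p) ≥ m, and m is unbounded.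
module Submission where

open import Defs
open import Data.Nat using (ℕ; zero; suc; _≤_; _<_; _+_; _⊔_; _≟_; _≡ᵇ_; s≤s; z≤n)
open import Data.Nat.Properties
  using (module ≤-Reasoning; ≤-refl; ≤-trans; ≤-reflexive; ≤-antisym; ≤-total; ≤-pred; m≤m⊔n; m≤n⊔m; ⊔-lub;
         m≤m+n; m≤n+m; ≡ᵇ⇒≡; ≡⇒≡ᵇ; 1+n≢n)
open import Data.Bool using (Bool; true; false; not; T; T?)
open import Data.Bool.Properties using (T-∧; not-¬; ¬-not)
open import Data.Unit using (tt)
open import Data.Empty using (⊥; ⊥-elim)
open import Data.Maybe using (just)
open import Data.Maybe.Properties using (just-injective)
open import Data.Fin using (Fin; toℕ; punchIn; punchOut) renaming (zero to fzero; suc to fsuc; _≟_ to _≟ᶠ_)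
import Data.Fin as Fin
open import Data.Fin.Properties using (toℕ-injective; suc-injective; punchIn-injective; punchIn-punchOut; punchInᵢ≢i)
open import Data.Vec using (Vec; []; _∷_)
import Data.Vec.Membership.Propositional as Vec
open import Data.Vec.Relation.Unary.Any using () renaming (here to vhere; there to vthere)
open import Data.Vec.Membership.Propositional.Properties using (∈-toList⁺)
open import Data.List using (List; []; _∷_; _++_; [_]; map; length; lookup; allFin; tabulate; filter; foldr; removeAt)
open import Data.List.Properties using (++-assoc; ++-identityʳ; map-++; map-∘; length-map; length-tabulate; length-removeAt′)
open import Data.List.Membership.Propositional using (_∈_; _∉_; find)
open import Data.List.Membership.Propositional.Properties
  using (∈-filter⁺; ∈-filter⁻; ∈-lookup; ∈-map⁺; ∈-map⁻; ∈-allFin; ∈-∃++; ∈-++⁻; ∈-++⁺ˡ; ∈-++⁺ʳ)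
open import Data.List.Membership.DecPropositional _≟_ using (_∈?_)
open import Data.List.Relation.Unary.Any using (here; there; index)
open import Data.List.Relation.Unary.Any.Properties using (lookup-index)
open import Data.List.Relation.Unary.All using (All; []; _∷_; all?) renaming (lookup to All-lookup; tabulate to All-tabulate)
open import Data.List.Relation.Unary.All.Properties using (¬All⇒Any¬)
import Data.List.Relation.Unary.All.Properties as All
open import Data.List.Relation.Unary.AllPairs using (AllPairs; []; _∷_)
import Data.List.Relation.Unary.AllPairs.Properties as AllPairs
open import Data.List.Relation.Unary.Linked using (Linked; [-])
open import Data.List.Relation.Unary.Linked.Properties using (AllPairs⇒Linked)
open import Data.List.Relation.Unary.Unique.Propositional using (Unique)
import Data.List.Relation.Unary.Unique.Propositional.Properties as Unique
open import Data.List.Relation.Binary.Permutation.Propositional using (_↭_; ↭-refl; ↭-sym; ↭-trans; prep)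
open import Data.List.Relation.Binary.Permutation.Propositional.Properties using (shift)
open import Data.List.Relation.Binary.Sublist.Propositional using (_∷ʳ_; _∷_) renaming (_⊆_ to _⊑_; ⊆-refl to ⊑-refl)
open import Data.List.Relation.Binary.Subset.Propositional using (_⊆_)
open import Data.Product using (Σ; ∃; ∃₂; _×_; _,_; proj₁; proj₂)
open import Data.Sum using (_⊎_; inj₁; inj₂)
open import Function using (_∘_; Equivalence)
open import Relation.Nullary using (¬_; Dec; does; yes; no; ¬?; contradiction)
open import Relation.Nullary.Decidable using (map′; decidable-stable)
open import Relation.Binary.PropositionalEquality using (_≡_; _≢_; refl; sym; trans; cong; cong₂; subst)

-- A record rather than T (satLetter as v l), so that as, v and l can be inferred.
record Satisfies {n} (as : Vec ℕ n) (v : Vec Bool n) (l : ℕ × Bool) : Set where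
  constructor satisfies
  field satisfied : T (satLetter as v l)
open Satisfies

Satisfies? : ∀ {n} (as : Vec ℕ n) v l → Dec (Satisfies as v l)
Satisfies? as v l = map′ satisfies satisfied (T? (satLetter as v l))

beq⇒≡ : ∀ {b x} → T (beq b x) → b ≡ x
beq⇒≡ {true}  {true}  _ = refl
beq⇒≡ {false} {false} _ = refl

beq-refl : ∀ b → T (beq b b)
beq-refl true  = tt
beq-refl false = tt

valueAt-∈ : ∀ {n} {as : Vec ℕ n} {i} (v : Vec Bool n) → i Vec.∈ as → ∃ λ x → valueAt as v i ≡ just x
valueAt-∈ {as = a ∷ as} {i} (x ∷ v) i∈ with a ≡ᵇ i in eq | i∈
... | true  | _          = x , refl
... | false | vthere i∈′ = valueAt-∈ v i∈′
... | false | vhere refl = ⊥-elim (subst T eq (≡⇒≡ᵇ a a refl))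

valueAt-just⇒∈ : ∀ {n} {as : Vec ℕ n} {v i x} → valueAt as v i ≡ just x → i Vec.∈ as
valueAt-just⇒∈ {as = []}     {[]}    ()
valueAt-just⇒∈ {as = a ∷ as} {_ ∷ v} {i} eq with a ≡ᵇ i in a≡ᵇi
... | true  = vhere (sym (≡ᵇ⇒≡ a i (subst T (sym a≡ᵇi) tt)))
... | false = vthere (valueAt-just⇒∈ eq)

module _ {n : ℕ} {as : Vec ℕ n} {v : Vec Bool n} where

  satLetter-just : ∀ {i x} b → valueAt as v i ≡ just x → satLetter as v (i , b) ≡ beq b x
  satLetter-just {i} b eq with valueAt as v i
  ... | just _ = cong (beq b) (just-injective eq)

  Satisfies⇒valueAt : ∀ {i b} → Satisfies as v (i , b) → valueAt as v i ≡ just b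
  Satisfies⇒valueAt {i} {b} (satisfies s) with valueAt as v i
  ... | just x = cong just (sym (beq⇒≡ s))

  valueAt⇒Satisfies : ∀ {i b} → valueAt as v i ≡ just b → Satisfies as v (i , b)
  valueAt⇒Satisfies {b = b} eq = satisfies (subst T (sym (satLetter-just b eq)) (beq-refl b))

  Satisfies-not⁺ : ∀ {i b} → i Vec.∈ as → ¬ Satisfies as v (i , b) → Satisfies as v (i , not b)
  Satisfies-not⁺ {b = b} i∈ ¬s with valueAt-∈ v i∈
  ... | x , eq = valueAt⇒Satisfies (trans eq (cong just (¬-not (b≢x ∘ sym))))
    where
    b≢x : b ≢ x
    b≢x b≡x = ¬s (valueAt⇒Satisfies (trans eq (cong just (sym b≡x))))

  Satisfies-not⁻ : ∀ {i b} → Satisfies as v (i , not b) → ¬ Satisfies as v (i , b)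
  Satisfies-not⁻ {b = b} s s′ =
    not-¬ refl (just-injective (trans (sym (Satisfies⇒valueAt s′)) (Satisfies⇒valueAt s)))

  satWord⇒All : ∀ w → T (satWord as v w) → All (Satisfies as v) w
  satWord⇒All []      _ = []
  satWord⇒All (l ∷ w) s = let sl , sw = Equivalence.to T-∧ s in satisfies sl ∷ satWord⇒All w sw

  All⇒satWord : ∀ {w} → All (Satisfies as v) w → T (satWord as v w)
  All⇒satWord []       = tt
  All⇒satWord (s ∷ ss) = Equivalence.from T-∧ (satisfied s , All⇒satWord ss)

module _ {T : Table} {w : Word} {r : Row (ncols T)} where

  ∈-sub⁺ : r ∈ rows T → All (Satisfies (attrs T) (proj₁ r)) w → r ∈ rows (sub T w)
  ∈-sub⁺ r∈ s = ∈-filter⁺ (T? ∘ λ r → satWord (attrs T) (proj₁ r) w) r∈ (All⇒satWord s)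

  ∈-sub⁻ : r ∈ rows (sub T w) → r ∈ rows T × All (Satisfies (attrs T) (proj₁ r)) w
  ∈-sub⁻ r∈ = let r∈T , s = ∈-filter⁻ (T? ∘ λ r → satWord (attrs T) (proj₁ r) w) r∈
              in r∈T , satWord⇒All w s

∈⇒nonEmpty : ∀ {T r} → r ∈ rows T → ¬ IsEmpty T
∈⇒nonEmpty r∈ empty = contradiction (subst (_ ∈_) empty r∈) λ ()

attrsOf : Word → List ℕ
attrsOf = map proj₁

∈-attrsOf-++⁺ˡ : ∀ {x} w₀ {w} → x ∈ attrsOf w₀ → x ∈ attrsOf (w₀ ++ w)
∈-attrsOf-++⁺ˡ w₀ {w} x∈ = subst (_ ∈_) (sym (map-++ proj₁ w₀ w)) (∈-++⁺ˡ x∈)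

∈-attrsOf-++⁺ʳ : ∀ {x} w₀ {w} → x ∈ attrsOf w → x ∈ attrsOf (w₀ ++ w)
∈-attrsOf-++⁺ʳ w₀ {w} x∈ = subst (_ ∈_) (sym (map-++ proj₁ w₀ w)) (∈-++⁺ʳ (attrsOf w₀) x∈)

↭-extract : ∀ {A : Set} {S w : List A} → Unique S → S ⊆ w → ∃ λ rest → w ↭ S ++ rest
↭-extract {S = []}    {w} _          _   = w , ↭-refl
↭-extract {S = x ∷ S} (x∉S ∷ uS) S⊆w with ∈-∃++ (S⊆w (here refl))
... | ys , zs , refl =
  let rest , p = ↭-extract uS S⊆ys++zs in rest , ↭-trans (shift x ys zs) (prep x p)
  where
  S⊆ys++zs : S ⊆ ys ++ zs
  S⊆ys++zs y∈S with ∈-++⁻ ys (S⊆w (there y∈S))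
  ... | inj₁ y∈ys          = ∈-++⁺ˡ y∈ys
  ... | inj₂ (here refl)   = contradiction refl (All-lookup x∉S y∈S)
  ... | inj₂ (there y∈zs)  = ∈-++⁺ʳ ys y∈zs

module Measure {ψ : List ℕ → ℕ} (B : BoundedComplexityMeasure ψ) where
  open BoundedComplexityMeasure B

  ψ-mono-⊆ : ∀ {S w} → Unique S → S ⊆ w → ψ S ≤ ψ w
  ψ-mono-⊆ {S} uS S⊆w =
    let rest , p = ↭-extract uS S⊆w
    in ≤-trans (monotone S rest) (≤-reflexive (perm-inv _ _ (↭-sym p)))

  nodeCost-edge : ∀ {b v es} acc → EdgeIn b v es → nodeCost ψ acc v ≤ edgesCost ψ acc es
  nodeCost-edge acc hereL                           = ≤-refl
  nodeCost-edge acc hereC                           = m≤m⊔n _ _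
  nodeCost-edge {es = consE _ v′ _} acc (thereC e) = ≤-trans (nodeCost-edge acc e) (m≤n⊔m (nodeCost ψ acc v′) _)

  nodeCost-path : ∀ {v w d} acc → NodePath v w d → ψ (acc ++ attrsOf w) ≤ nodeCost ψ acc v
  nodeCost-path acc leafP = ≤-reflexive (cong ψ (++-identityʳ acc))
  nodeCost-path acc (queryP {i = i} {w = w} e np) =
    ≤-trans (≤-reflexive (cong ψ (sym (++-assoc acc [ i ] (attrsOf w)))))
            (≤-trans (nodeCost-path (acc ++ [ i ]) np) (nodeCost-edge _ e))

  treeCost-child : ∀ {v Γ} → ChildOfRoot v Γ → nodeCost ψ [] v ≤ treeCost ψ Γ
  treeCost-child hereL                        = ≤-refl
  treeCost-child hereC                        = m≤m⊔n _ _
  treeCost-child {Γ = consR v′ _} (thereC c) = ≤-trans (treeCost-child c) (m≤n⊔m (nodeCost ψ [] v′) _)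

  treeCost-path : ∀ {Γ w d} → Path Γ w d → ψ (attrsOf w) ≤ treeCost ψ Γ
  treeCost-path (v , c , np) = ≤-trans (nodeCost-path [] np) (treeCost-child c)

mutual
  nodeSize : Node → ℕ
  nodeSize (leaf _)     = 1
  nodeSize (query _ es) = suc (edgesSize es)

  edgesSize : Edges → ℕ
  edgesSize (lastE _ v)    = nodeSize v
  edgesSize (consE _ v es) = nodeSize v + edgesSize es

nodeSize-edge : ∀ {b c es} → EdgeIn b c es → nodeSize c ≤ edgesSize es
nodeSize-edge hereL                           = ≤-refl
nodeSize-edge {c = c} {consE _ _ es} hereC    = m≤m+n (nodeSize c) (edgesSize es)
nodeSize-edge {es = consE _ v es} (thereC e)  = ≤-trans (nodeSize-edge e) (m≤n+m (edgesSize es) (nodeSize v))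

∈-edgeLabels : ∀ {b c es} → EdgeIn b c es → b ∈ edgeLabels es
∈-edgeLabels hereL      = here refl
∈-edgeLabels hereC      = here refl
∈-edgeLabels (thereC e) = there (∈-edgeLabels e)

EdgeIn-unique : ∀ {b c c′ es} → AllPairs _≢_ (edgeLabels es) → EdgeIn b c es → EdgeIn b c′ es → c ≡ c′
EdgeIn-unique _          hereL      hereL       = refl
EdgeIn-unique _          hereC      hereC       = refl
EdgeIn-unique (b∉ ∷ _)   hereC      (thereC e′) = contradiction refl (All-lookup b∉ (∈-edgeLabels e′))
EdgeIn-unique (b∉ ∷ _)   (thereC e) hereC       = contradiction refl (All-lookup b∉ (∈-edgeLabels e))
EdgeIn-unique (_ ∷ dist) (thereC e) (thereC e′) = EdgeIn-unique dist e e′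

DetEdges-child : ∀ {b c es} → DetEdges es → EdgeIn b c es → DetNode c
DetEdges-child det       hereL      = det
DetEdges-child (det , _) hereC      = det
DetEdges-child (_ , det) (thereC e) = DetEdges-child det e

NodePath-exists : ∀ v → ∃₂ λ w d → NodePath v w d
NodePath-exists (leaf d) = [] , d , leafP
NodePath-exists (query i (lastE b c)) =
  let w , d , np = NodePath-exists c in (i , b) ∷ w , d , queryP hereL np
NodePath-exists (query i (consE b c _)) =
  let w , d , np = NodePath-exists c in (i , b) ∷ w , d , queryP hereC np

argmin : ∀ {m} (f : Fin (suc m) → ℕ) → ∃ λ k → ∀ j → f k ≤ f j
argmin {zero}  f = fzero , λ { fzero → ≤-refl }
argmin {suc m} f with argmin (f ∘ fsuc)
... | k , min with ≤-total (f fzero) (f (fsuc k))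
...   | inj₁ le = fzero  , λ { fzero → ≤-refl ; (fsuc j) → ≤-trans le (min j) }
...   | inj₂ ge = fsuc k , λ { fzero → ge     ; (fsuc j) → min j }

atMostOne⊎two : ∀ {m} {P : Fin (suc m) → Set} → (∀ p → Dec (P p)) →
                (∃ λ s → ∀ p → p ≢ s → ¬ P p) ⊎ (∃₂ λ p q → p ≢ q × P p × P q)
atMostOne⊎two {zero} P? = inj₁ (fzero , λ { fzero 0≢0 → contradiction refl 0≢0 })
atMostOne⊎two {suc m} {P} P? with atMostOne⊎two (P? ∘ fsuc) | P? fzero
... | inj₂ (p , q , p≢q , Pp , Pq) | _ = inj₂ (fsuc p , fsuc q , p≢q ∘ suc-injective , Pp , Pq)
... | inj₁ (s , ¬P) | no ¬P0 = inj₁ (fsuc s , λ { fzero _ → ¬P0 ; (fsuc p) p≢s → ¬P p (p≢s ∘ cong fsuc) })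
... | inj₁ (s , ¬P) | yes P0 with P? (fsuc s)
...   | yes Ps = inj₂ (fzero , fsuc s , (λ ()) , P0 , Ps)
...   | no ¬Ps = inj₁ (fzero , ¬P′)
  where
  ¬P′ : ∀ p → p ≢ fzero → ¬ P p
  ¬P′ fzero    0≢0 = contradiction refl 0≢0
  ¬P′ (fsuc p) _ with p ≟ᶠ s
  ... | yes refl = ¬Ps
  ... | no p≢s   = ¬P p p≢s

module _ {A : Set} where

  removeAt-⊑ : ∀ (xs : List A) i → removeAt xs i ⊑ xs
  removeAt-⊑ (x ∷ xs) fzero    = x ∷ʳ ⊑-refl
  removeAt-⊑ (x ∷ xs) (fsuc i) = refl ∷ removeAt-⊑ xs i

  removeAt-≢ : ∀ (xs : List A) i → removeAt xs i ≢ xs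
  removeAt-≢ xs i eq = 1+n≢n (trans (sym (length-removeAt′ xs i)) (cong length (sym eq)))

  ∈-removeAt⁻ : ∀ {x} (xs : List A) i → x ∈ removeAt xs i → x ∈ xs
  ∈-removeAt⁻ (_ ∷ _)  fzero    x∈        = there x∈
  ∈-removeAt⁻ (_ ∷ _)  (fsuc i) (here eq) = here eq
  ∈-removeAt⁻ (_ ∷ xs) (fsuc i) (there x∈) = there (∈-removeAt⁻ xs i x∈)

  ∈-removeAt⁺ : ∀ (xs : List A) {i q} → q ≢ i → lookup xs q ∈ removeAt xs i
  ∈-removeAt⁺ (_ ∷ _)  {fzero}  {fzero}  q≢i = contradiction refl q≢i
  ∈-removeAt⁺ (_ ∷ xs) {fzero}  {fsuc q} _   = ∈-lookup {xs = xs} q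
  ∈-removeAt⁺ (_ ∷ _)  {fsuc _} {fzero}  _   = here refl
  ∈-removeAt⁺ (_ ∷ xs) {fsuc i} {fsuc q} q≢i = there (∈-removeAt⁺ xs (q≢i ∘ cong fsuc))

allFinExcept : ∀ {m} → Fin (suc m) → List (Fin (suc m))
allFinExcept p = map (punchIn p) (allFin _)

module _ {m : ℕ} (p : Fin (suc m)) where

  ∈-allFinExcept⁺ : ∀ {q} → q ≢ p → q ∈ allFinExcept p
  ∈-allFinExcept⁺ q≢p = subst (_∈ allFinExcept p) (punchIn-punchOut (q≢p ∘ sym))
                          (∈-map⁺ (punchIn p) (∈-allFin (punchOut (q≢p ∘ sym))))

  ∈-allFinExcept⁻ : ∀ {q} → q ∈ allFinExcept p → q ≢ p
  ∈-allFinExcept⁻ q∈ with ∈-map⁻ (punchIn p) q∈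
  ... | j , _ , refl = punchInᵢ≢i p j

  allFinExcept-unique : Unique (allFinExcept p)
  allFinExcept-unique = Unique.map⁺ (punchIn-injective p _ _) (Unique.allFin⁺ m)

  length-allFinExcept : length (allFinExcept p) ≡ m
  length-allFinExcept = trans (length-map (punchIn p) (allFin m)) (length-tabulate (λ x → x))

orZero : List ℕ → List ℕ
orZero []       = [ 0 ]
orZero (x ∷ xs) = x ∷ xs

orZero-canonical : ∀ {xs} → Linked _<_ xs → CanonicalDecSet (orZero xs)
orZero-canonical {[]}    _    = (λ ()) , [-]
orZero-canonical {_ ∷ _} sort = (λ ()) , sort

orZero-∈ : ∀ {x xs} → x ∈ xs → orZero xs ≡ xs
orZero-∈ (here _)  = refl
orZero-∈ (there _) = refl

module ViolationTable {k : ℕ} (As : Vec ℕ k) (l₀ : ℕ × Bool) (α₀ : Word) where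

  α : Word
  α = l₀ ∷ α₀

  Pos : Set
  Pos = Fin (length α)

  attr : Pos → ℕ
  attr p = proj₁ (lookup α p)

  val : Pos → Bool
  val p = proj₂ (lookup α p)

  Violates : Vec Bool k → Pos → Set
  Violates v p = ¬ Satisfies As v (lookup α p)

  Violates? : ∀ v p → Dec (Violates v p)
  Violates? v p = ¬? (Satisfies? As v (lookup α p))

  violations : Vec Bool k → List ℕ
  violations v = map toℕ (filter (Violates? v) (allFin _))

  violations-sorted : ∀ v → Linked _<_ (violations v)
  violations-sorted v =
    AllPairs⇒Linked (AllPairs.map⁺ (AllPairs.filter⁺ (Violates? v) (AllPairs.tabulate⁺-< {R = Fin._<_} (λ i<j → i<j))))

  ∈-violations⁺ : ∀ {v p} → Violates v p → toℕ p ∈ violations v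
  ∈-violations⁺ {v} {p} viol = ∈-map⁺ toℕ (∈-filter⁺ (Violates? v) (∈-allFin p) viol)

  ∈-violations⁻ : ∀ {v d} → d ∈ violations v → ∃ λ p → d ≡ toℕ p × Violates v p
  ∈-violations⁻ {v} d∈ with ∈-map⁻ toℕ d∈
  ... | p , p∈ , refl = p , refl , proj₂ (∈-filter⁻ (Violates? v) p∈)

  -- {0} is a junk value: rows of a violation table always violate some letter.
  ν : Vec Bool k → DecSet
  ν v = orZero (violations v)

  ν-canonical : CanonicalMap ν
  ν-canonical v = orZero-canonical (violations-sorted v)

  ∈-ν⁺ : ∀ {v p} → Violates v p → toℕ p ∈ ν v
  ∈-ν⁺ {v} {p} viol = subst (_ ∈_) (sym (orZero-∈ (∈-violations⁺ {v} {p} viol))) (∈-violations⁺ {v} {p} viol)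

  ∈-ν⁻ : ∀ {v q d} → Violates v q → d ∈ ν v → ∃ λ p → d ≡ toℕ p × Violates v p
  ∈-ν⁻ {v} {q} viol d∈ = ∈-violations⁻ (subst (_ ∈_) (orZero-∈ (∈-violations⁺ {v} {q} viol)) d∈)

  record IsViolationTable (R : List (Row k)) : Set where
    field
      decision-ν        : ∀ {r} → r ∈ R → proj₂ r ≡ ν (proj₁ r)
      violates-some     : ∀ {r} → r ∈ R → ∃ (Violates (proj₁ r))
      witness           : Pos → Row k
      witness-∈         : ∀ p → witness p ∈ R
      witness-violates  : ∀ p → Violates (proj₁ (witness p)) p
      witness-satisfies : ∀ {p q} → q ≢ p → Satisfies As (proj₁ (witness p)) (lookup α q)
      attrs⊆α           : ∀ {i} → i Vec.∈ As → ∃ λ p → attr p ≡ i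
      α⊆attrs           : ∀ p → attr p Vec.∈ As
      noConflict        : NoConflict α

  module Complexity {ψ : List ℕ → ℕ} (B : BoundedComplexityMeasure ψ)
                    {R : List (Row k)} (V : IsViolationTable R) where
    open BoundedComplexityMeasure B
    open Measure B
    open IsViolationTable V

    T′ : Table
    T′ = mkTable k As R

    LeafCorrect : Word → ℕ → Set
    LeafCorrect w d = IsEmpty (sub T′ w) ⊎ InΠ d (sub T′ w)

    wv : Pos → Vec Bool k
    wv p = proj₁ (witness p)

    witness-value : ∀ {p q} → q ≢ p → valueAt As (wv p) (attr q) ≡ just (val q)
    witness-value q≢p = Satisfies⇒valueAt (witness-satisfies q≢p)

    witness-satisfies-val : ∀ {p q b} → q ≢ p → Satisfies As (wv p) (attr q , b) → b ≡ val q
    witness-satisfies-val q≢p sat = just-injective (trans (sym (Satisfies⇒valueAt sat)) (witness-value q≢p))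

    satisfied-attr : ∀ {v i b} → Satisfies As v (i , b) → ∃ λ p → attr p ≡ i
    satisfied-attr s = attrs⊆α (valueAt-just⇒∈ (Satisfies⇒valueAt s))

    -- witness q satisfies α_p but violates α_q, so equal attributes would force
    -- α to contain two conflicting letters
    attr-injective : ∀ {p q} → attr p ≡ attr q → p ≡ q
    attr-injective {p} {q} eq with p ≟ᶠ q
    ... | yes p≡q = p≡q
    ... | no  p≢q = ⊥-elim (witness-violates q (valueAt⇒Satisfies (begin
          valueAt As (wv q) (attr q) ≡⟨ cong (valueAt As (wv q)) (sym eq) ⟩
          valueAt As (wv q) (attr p) ≡⟨ witness-value p≢q ⟩
          just (val p)               ≡⟨ cong just val-p≡val-q ⟩
          just (val q)               ∎)))
      where
      open Relation.Binary.PropositionalEquality.≡-Reasoning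
      val-p≡val-q : val p ≡ val q
      val-p≡val-q = noConflict (attr p) (val p) (val q) (∈-lookup {xs = α} p)
                      (subst (λ i → (i , val q) ∈ α) (sym eq) (∈-lookup {xs = α} q))

    witness-decision : ∀ {p d} → d ∈ proj₂ (witness p) → d ≡ toℕ p
    witness-decision {p} {d} d∈ with ∈-ν⁻ {q = p} (witness-violates p) (subst (d ∈_) (decision-ν (witness-∈ p)) d∈)
    ... | q , refl , viol with q ≟ᶠ p
    ... | yes refl = refl
    ... | no  q≢p  = contradiction (witness-satisfies q≢p) viol

    witness-∈-sub : ∀ {p w} → All (Satisfies As (wv p)) w → witness p ∈ rows (sub T′ w)
    witness-∈-sub {p} = ∈-sub⁺ (witness-∈ p)

    witnesses-separated : ∀ {w d p q} → LeafCorrect w d →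
                          witness p ∈ rows (sub T′ w) → witness q ∈ rows (sub T′ w) → p ≡ q
    witnesses-separated {w} (inj₁ empty) p∈ _ = contradiction empty (∈⇒nonEmpty {sub T′ w} p∈)
    witnesses-separated {p = p} {q} (inj₂ Π) p∈ q∈ =
      toℕ-injective (trans (sym (witness-decision {p} (All-lookup Π p∈))) (witness-decision {q} (All-lookup Π q∈)))

    T′-nonEmpty : ¬ IsEmpty T′
    T′-nonEmpty = ∈⇒nonEmpty {T′} (witness-∈ fzero)

    attrsExcept : Pos → List ℕ
    attrsExcept p = map attr (allFinExcept p)

    attrsExcept-unique : ∀ p → Unique (attrsExcept p)
    attrsExcept-unique p = Unique.map⁺ attr-injective (allFinExcept-unique p)

    length≤ψ-attrsExcept : ∀ p → length α₀ ≤ ψ (attrsExcept p)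
    length≤ψ-attrsExcept p =
      ≤-trans (≤-reflexive (sym (trans (length-map attr (allFinExcept p)) (length-allFinExcept p)))) (bounded _)

    starNode : Pos → Node
    starNode p = query (attr p) (lastE (not (val p)) (leaf (toℕ p)))

    star : Pos → List Pos → Tree
    star p []       = lastR (starNode p)
    star p (q ∷ qs) = consR (starNode p) (star q qs)

    starTree : Tree
    starTree = star fzero (tabulate fsuc)

    star-child⁺ : ∀ {p q qs} → p ∈ q ∷ qs → ChildOfRoot (starNode p) (star q qs)
    star-child⁺ {qs = []}    (here refl) = hereL
    star-child⁺ {qs = _ ∷ _} (here refl) = hereC
    star-child⁺ {qs = _ ∷ _} (there p∈)  = thereC (star-child⁺ p∈)

    star-child⁻ : ∀ {v} q qs → ChildOfRoot v (star q qs) → ∃ λ p → v ≡ starNode p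
    star-child⁻ q []       hereL      = q , refl
    star-child⁻ q (_ ∷ _)  hereC      = q , refl
    star-child⁻ _ (q ∷ qs) (thereC c) = star-child⁻ q qs c

    star-attrs : ∀ q qs → TreeAttrsIn As (star q qs)
    star-attrs q []        = α⊆attrs q , tt
    star-attrs q (q′ ∷ qs) = (α⊆attrs q , tt) , star-attrs q′ qs

    treeCost-star≤ : ∀ {X} q qs → (∀ p → ψ [ attr p ] ≤ X) → treeCost ψ (star q qs) ≤ X
    treeCost-star≤ q []        bound = bound q
    treeCost-star≤ q (q′ ∷ qs) bound = ⊔-lub (bound q) (treeCost-star≤ q′ qs bound)

    starTree-for : NondetTreeFor T′ starTree
    starTree-for = star-attrs fzero (tabulate fsuc) , cover , correct
      where
      cover : ∀ r → r ∈ R → ∃₂ λ w d → Path starTree w d × r ∈ rows (sub T′ w)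
      cover r r∈ with violates-some r∈
      ... | p , viol = [ (attr p , not (val p)) ] , toℕ p ,
                       (starNode p , star-child⁺ (∈-allFin p) , queryP hereL leafP) ,
                       ∈-sub⁺ {T′} r∈ (Satisfies-not⁺ (α⊆attrs p) viol ∷ [])
      correct : ∀ w d → Path starTree w d → LeafCorrect w d
      correct w d (v , c , np) with star-child⁻ fzero (tabulate fsuc) c
      ... | p , refl with np
      ... | queryP hereL leafP = inj₂ (All-tabulate λ r∈ → labelled (∈-sub⁻ {T′} r∈))
        where
        labelled : ∀ {r} → r ∈ R × All (Satisfies As (proj₁ r)) [ (attr p , not (val p)) ] → toℕ p ∈ proj₂ r
        labelled (r∈ , s ∷ []) = subst (toℕ p ∈_) (sym (decision-ν r∈)) (∈-ν⁺ {p = p} (Satisfies-not⁻ s))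

    -- Every other witness has to be kept out of the leaf, and only a query of its own
    -- attribute can separate it from witness p.
    queries-others : ∀ {w d p q} → LeafCorrect w d → witness p ∈ rows (sub T′ w) →
                     attr p ∉ attrsOf w → q ≢ p → attr q ∈ attrsOf w
    queries-others {w} {d} {p} {q} ok p∈ p∉ q≢p with all? (Satisfies? As (wv q)) w
    ... | yes q-sat = contradiction (witnesses-separated {w} ok (witness-∈-sub {q} q-sat) p∈) q≢p
    ... | no ¬q-sat with find (¬All⇒Any¬ (Satisfies? As (wv q)) w ¬q-sat)
    ... | (i , b) , l∈ , q-viol with All-lookup (proj₂ (∈-sub⁻ {T′} p∈)) l∈
    ... | p-sat with satisfied-attr p-sat
    ... | r , refl with r ≟ᶠ p | r ≟ᶠ q
    ... | yes refl | _        = contradiction (∈-map⁺ proj₁ l∈) p∉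
    ... | no _     | yes refl = ∈-map⁺ proj₁ l∈
    ... | no r≢p   | no r≢q   =
      contradiction (subst (λ b → Satisfies As (wv q) (attr r , b)) (sym (witness-satisfies-val r≢p p-sat))
                                 (witness-satisfies r≢q)) q-viol

    nondet-lower : (∀ p → ψ [ attr p ] ≤ length α₀) →
                   ∀ {Γ} → NondetTreeFor T′ Γ → ∀ p → ψ [ attr p ] ≤ treeCost ψ Γ
    nondet-lower short {Γ} (_ , cover , correct) p with cover (witness p) (witness-∈ p)
    ... | w , d , path , p∈ with attr p ∈? attrsOf w
    ... | yes a∈ = ≤-trans (ψ-mono-⊆ ([] ∷ []) λ { (here refl) → a∈ }) (treeCost-path path)
    ... | no  a∉ = begin
      ψ [ attr p ]      ≤⟨ short p ⟩
      length α₀         ≤⟨ length≤ψ-attrsExcept p ⟩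
      ψ (attrsExcept p) ≤⟨ ψ-mono-⊆ (attrsExcept-unique p) others⊆ ⟩
      ψ (attrsOf w)     ≤⟨ treeCost-path path ⟩
      treeCost ψ Γ      ∎
      where
      open ≤-Reasoning
      others⊆ : attrsExcept p ⊆ attrsOf w
      others⊆ a∈ with ∈-map⁻ attr a∈
      ... | q , q∈ , refl = queries-others (correct w d path) p∈ a∉ (∈-allFinExcept⁻ p q∈)

    ψᵃ-T′ : (∀ p → ψ [ attr p ] ≤ length α₀) → IsPsiA ψ T′ (treeCost ψ starTree)
    ψᵃ-T′ short = inj₂ (T′-nonEmpty , (starTree , starTree-for , refl) ,
                        λ Γ Γ-for → treeCost-star≤ fzero (tabulate fsuc) (nondet-lower short Γ-for))

    -- Test the letters other than α_s in turn, stopping at the first violated one; a row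
    -- satisfying all of them must violate α_s.
    module Chain (s : Pos) where

      chain : List Pos → Node
      chain []       = leaf (toℕ s)
      chain (p ∷ ps) = query (attr p) (consE (not (val p)) (leaf (toℕ p)) (lastE (val p) (chain ps)))

      chain-attrs : ∀ ps → NodeAttrsIn As (chain ps)
      chain-attrs []       = tt
      chain-attrs (p ∷ ps) = α⊆attrs p , tt , chain-attrs ps

      chain-det : ∀ ps → DetNode (chain ps)
      chain-det []       = tt
      chain-det (p ∷ ps) = ((not-¬ refl ∘ sym) ∷ []) ∷ [] ∷ [] , tt , chain-det ps

      chain-cover : ∀ ps v → ∃₂ λ w d → NodePath (chain ps) w d × All (Satisfies As v) w
      chain-cover []       v = [] , toℕ s , leafP , []
      chain-cover (p ∷ ps) v with Satisfies? As v (lookup α p)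
      ... | yes sat = let w , d , np , sats = chain-cover ps v
                      in (attr p , val p) ∷ w , d , queryP (thereC hereL) np , sat ∷ sats
      ... | no viol = [ (attr p , not (val p)) ] , toℕ p , queryP hereC leafP ,
                      Satisfies-not⁺ (α⊆attrs p) viol ∷ []

      chain-leaf : ∀ ps {w d v} → NodePath (chain ps) w d → All (Satisfies As v) w →
                   (d ≡ toℕ s × All (Satisfies As v ∘ lookup α) ps) ⊎ (∃ λ q → d ≡ toℕ q × Violates v q)
      chain-leaf []       leafP                        _            = inj₁ (refl , [])
      chain-leaf (p ∷ ps) (queryP hereC leafP)         (sat ∷ [])   = inj₂ (p , refl , Satisfies-not⁻ sat)
      chain-leaf (p ∷ ps) (queryP (thereC hereL) np)   (sat ∷ sats) with chain-leaf ps np sats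
      ... | inj₁ (refl , sats′) = inj₁ (refl , sat ∷ sats′)
      ... | inj₂ viol           = inj₂ viol

      nodeCost-chain≤ : ∀ ps acc → nodeCost ψ acc (chain ps) ≤ ψ (acc ++ map attr ps)
      nodeCost-chain≤ []       acc = ≤-reflexive (cong ψ (sym (++-identityʳ acc)))
      nodeCost-chain≤ (p ∷ ps) acc =
        ⊔-lub (≤-trans (monotone (acc ++ [ attr p ]) (map attr ps)) reassoc)
              (≤-trans (nodeCost-chain≤ ps (acc ++ [ attr p ])) reassoc)
        where
        reassoc : ψ ((acc ++ [ attr p ]) ++ map attr ps) ≤ ψ (acc ++ attr p ∷ map attr ps)
        reassoc = ≤-reflexive (cong ψ (++-assoc acc [ attr p ] (map attr ps)))

      chain-path : ∀ ps → NodePath (chain ps) (map (lookup α) ps) (toℕ s)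
      chain-path []       = leafP
      chain-path (p ∷ ps) = queryP (thereC hereL) (chain-path ps)

      chainTree : Tree
      chainTree = lastR (chain (allFinExcept s))

      chainTree-for : DetTreeFor T′ chainTree
      chainTree-for = (chain-attrs _ , cover , correct) , chain-det _
        where
        cover : ∀ r → r ∈ R → ∃₂ λ w d → Path chainTree w d × r ∈ rows (sub T′ w)
        cover r r∈ = let w , d , np , sats = chain-cover (allFinExcept s) (proj₁ r)
                     in w , d , (_ , hereL , np) , ∈-sub⁺ {T′} r∈ sats
        correct : ∀ w d → Path chainTree w d → LeafCorrect w d
        correct w d (_ , hereL , np) = inj₂ (All-tabulate λ r∈ → labelled (∈-sub⁻ {T′} {w} r∈))
          where
          labelled : ∀ {r} → r ∈ R × All (Satisfies As (proj₁ r)) w → d ∈ proj₂ r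
          labelled {r} (r∈ , sats) = subst (d ∈_) (sym (decision-ν r∈)) (∈ν (chain-leaf _ np sats))
            where
            ∈ν : (d ≡ toℕ s × All (Satisfies As (proj₁ r) ∘ lookup α) (allFinExcept s)) ⊎
                 (∃ λ q → d ≡ toℕ q × Violates (proj₁ r) q) → d ∈ ν (proj₁ r)
            ∈ν (inj₂ (q , refl , viol)) = ∈-ν⁺ {p = q} viol
            ∈ν (inj₁ (refl , sats′)) with violates-some r∈
            ... | q , viol with q ≟ᶠ s
            ... | yes refl = ∈-ν⁺ {p = q} viol
            ... | no  q≢s  = contradiction (All-lookup sats′ (∈-allFinExcept⁺ s q≢s)) viol

      treeCost-chainTree : treeCost ψ chainTree ≡ ψ (attrsExcept s)
      treeCost-chainTree = ≤-antisym (nodeCost-chain≤ (allFinExcept s) [])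
        (subst (λ as → ψ as ≤ treeCost ψ chainTree) (sym (map-∘ (allFinExcept s)))
               (treeCost-path (_ , hereL , chain-path (allFinExcept s))))

    -- Some path of a deterministic tree queries all attributes of α but one: follow the
    -- witnesses whose own attribute is not yet queried; they agree on every queried
    -- attribute, hence share the path, and no two of them can share a leaf.
    module DetLower (v₀ : Node)
                    (cover : ∀ r → r ∈ R → ∃₂ λ w d → Path (lastR v₀) w d × r ∈ rows (sub T′ w))
                    (correct : ∀ w d → Path (lastR v₀) w d → LeafCorrect w d) where

      record Reached (v : Node) (w₀ : Word) : Set where
        field
          toRoot  : ∀ {w d} → NodePath v w d → Path (lastR v₀) (w₀ ++ w) d
          agrees  : ∀ q → attr q ∉ attrsOf w₀ → All (Satisfies As (wv q)) w₀
          reaches : ∀ q → attr q ∉ attrsOf w₀ → ∃₂ λ w d → NodePath v w d × All (Satisfies As (wv q)) w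
      open Reached

      Result : Node → Word → Set
      Result v w₀ = ∃₂ λ w d → NodePath v w d × ∃ λ s → ∀ p → p ≢ s → attr p ∈ attrsOf (w₀ ++ w)

      root-reached : Reached v₀ []
      root-reached = record
        { toRoot  = λ np → v₀ , hereL , np
        ; agrees  = λ _ _ → []
        ; reaches = λ q _ → reach (cover (witness q) (witness-∈ q))
        }
        where
        reach : ∀ {q} → (∃₂ λ w d → Path (lastR v₀) w d × witness q ∈ rows (sub T′ w)) →
                ∃₂ λ w d → NodePath v₀ w d × All (Satisfies As (wv q)) w
        reach (w , d , (_ , hereL , np) , q∈) = w , d , np , proj₂ (∈-sub⁻ {T′} {w} q∈)

      two-unqueried-at-leaf : ∀ {d w₀ p q} → Reached (leaf d) w₀ → p ≢ q →
                              attr p ∉ attrsOf w₀ → attr q ∉ attrsOf w₀ → ⊥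
      two-unqueried-at-leaf {d} {w₀} {p} {q} st p≢q p∉ q∉ with reaches st p p∉ | reaches st q q∉
      ... | .[] , .d , leafP , _ | .[] , .d , leafP , _ =
        p≢q (witnesses-separated {w₀ ++ []} (correct _ _ (toRoot st leafP)) (arrives p p∉) (arrives q q∉))
        where
        arrives : ∀ r → attr r ∉ attrsOf w₀ → witness r ∈ rows (sub T′ (w₀ ++ []))
        arrives r r∉ = witness-∈-sub {r} (All.++⁺ (agrees st r r∉) [])

      unqueried-off : ∀ {w₀ p q} i → p ≢ q → attr p ∉ attrsOf w₀ → attr q ∉ attrsOf w₀ →
                      ∃ λ k → attr k ∉ attrsOf w₀ × attr k ≢ i
      unqueried-off {p = p} {q} i p≢q p∉ q∉ with attr p ≟ i
      ... | no  p≢i = p , p∉ , p≢i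
      ... | yes p≡i = q , q∉ , λ q≡i → p≢q (attr-injective (trans p≡i (sym q≡i)))

      step : ∀ {i es w₀ k} → Reached (query i es) w₀ → DetNode (query i es) →
             attr k ∉ attrsOf w₀ → attr k ≢ i →
             ∃₂ λ r c → attr r ≡ i × EdgeIn (val r) c es × Reached c (w₀ ++ [ lookup α r ])
      step {i} {es} {w₀} {k} st (dist , _) k∉ k≢i with reaches st k k∉
      ... | _ , _ , queryP {v = c} e _ , sat ∷ _ with satisfied-attr sat
      ... | r , refl = r , c , refl , e′ , record { toRoot = toRoot′ ; agrees = agrees′ ; reaches = reaches′ }
        where
        w₁ : Word
        w₁ = w₀ ++ [ lookup α r ]

        e′ : EdgeIn (val r) c es
        e′ = subst (λ b → EdgeIn b c es) (witness-satisfies-val {k} {r} (k≢i ∘ cong attr ∘ sym) sat) e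

        r≢ : ∀ {q} → attr q ∉ attrsOf w₁ → r ≢ q
        r≢ q∉ refl = q∉ (∈-attrsOf-++⁺ʳ w₀ (here refl))

        toRoot′ : ∀ {w d} → NodePath c w d → Path (lastR v₀) (w₁ ++ w) d
        toRoot′ {w} {d} np = subst (λ w′ → Path (lastR v₀) w′ d) (sym (++-assoc w₀ [ lookup α r ] w))
                                   (toRoot st (queryP e′ np))

        agrees′ : ∀ q → attr q ∉ attrsOf w₁ → All (Satisfies As (wv q)) w₁
        agrees′ q q∉ = All.++⁺ (agrees st q (q∉ ∘ ∈-attrsOf-++⁺ˡ w₀)) (witness-satisfies (r≢ q∉) ∷ [])

        reaches′ : ∀ q → attr q ∉ attrsOf w₁ → ∃₂ λ w d → NodePath c w d × All (Satisfies As (wv q)) w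
        reaches′ q q∉ with reaches st q (q∉ ∘ ∈-attrsOf-++⁺ˡ w₀)
        ... | _ , _ , queryP {v = c′} eq np , satq ∷ sats =
          _ , _ , subst (λ c → NodePath c _ _) (sym (EdgeIn-unique dist e′ eq′)) np , sats
          where
          eq′ : EdgeIn (val r) c′ es
          eq′ = subst (λ b → EdgeIn b c′ es) (witness-satisfies-val (r≢ q∉) satq) eq

      mutual
        walk : ∀ fuel v {w₀} → nodeSize v ≤ fuel → DetNode v → Reached v w₀ → Result v w₀
        walk fuel v {w₀} size det st with atMostOne⊎two (λ p → ¬? (attr p ∈? attrsOf w₀))
        ... | inj₁ (s , queried) =
          let w , d , np = NodePath-exists v
          in w , d , np , s , λ p p≢s → ∈-attrsOf-++⁺ˡ w₀ (decidable-stable (attr p ∈? _) (queried p p≢s))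
        ... | inj₂ (p , q , p≢q , p∉ , q∉) = descend fuel v size det st p≢q p∉ q∉

        descend : ∀ fuel v {w₀ p q} → nodeSize v ≤ fuel → DetNode v → Reached v w₀ → p ≢ q →
                  attr p ∉ attrsOf w₀ → attr q ∉ attrsOf w₀ → Result v w₀
        descend _ (leaf d) _ _ st p≢q p∉ q∉ = ⊥-elim (two-unqueried-at-leaf st p≢q p∉ q∉)
        descend (suc fuel) (query i es) {w₀} {p} {q} (s≤s size) det st p≢q p∉ q∉
          with unqueried-off {w₀} {p} {q} i p≢q p∉ q∉
        ... | k , k∉ , k≢i with step {k = k} st det k∉ k≢i
        ... | r , c , refl , e , st′
          with walk fuel c (≤-trans (nodeSize-edge e) size) (DetEdges-child (proj₂ det) e) st′
        ... | w , d , np , s , queried =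
          lookup α r ∷ w , d , queryP e np , s ,
          λ p p≢s → subst (λ w′ → attr p ∈ attrsOf w′) (++-assoc w₀ [ lookup α r ] w) (queried p p≢s)

    det-lower : ∀ {Γ} → DetTreeFor T′ Γ → ∃ λ s → ψ (attrsExcept s) ≤ treeCost ψ Γ
    det-lower {lastR v₀} ((_ , cover , correct) , det)
      with DetLower.walk v₀ cover correct (nodeSize v₀) v₀ ≤-refl det (DetLower.root-reached v₀ cover correct)
    ... | _ , _ , np , s , queried =
      s , ≤-trans (ψ-mono-⊆ (attrsExcept-unique s) others⊆) (treeCost-path (v₀ , hereL , np))
      where
      others⊆ : attrsExcept s ⊆ attrsOf _
      others⊆ a∈ with ∈-map⁻ attr a∈
      ... | q , q∈ , refl = queried q (∈-allFinExcept⁻ s q∈)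

    cheapest : Pos
    cheapest = proj₁ (argmin (ψ ∘ attrsExcept))

    ψᵈ-T′ : IsPsiD ψ T′ (ψ (attrsExcept cheapest))
    ψᵈ-T′ = inj₂ (T′-nonEmpty , (chainTree , chainTree-for , treeCost-chainTree) ,
                  λ Γ Γ-for → let s , s≤Γ = det-lower Γ-for in ≤-trans (proj₂ (argmin (ψ ∘ attrsExcept)) s) s≤Γ)
      where open Chain cheapest

veq⇒≡ : ∀ {m} {u w : Vec Bool m} → T (veq u w) → u ≡ w
veq⇒≡ {u = []}    {[]}    _ = refl
veq⇒≡ {u = x ∷ u} {y ∷ w} e = let ex , eu = Equivalence.to T-∧ e in cong₂ _∷_ (beq⇒≡ ex) (veq⇒≡ eu)

velem⇒∈ : ∀ {m} {u : Vec Bool m} ws → T (velem u ws) → u ∈ ws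
velem⇒∈ {u = u} (w ∷ ws) e with veq u w in eq
... | true  = here (veq⇒≡ (subst T (sym eq) tt))
... | false = there (velem⇒∈ ws e)

module _ {m : ℕ} where

  ∈-dedupFrom⁻ : ∀ seen (rs : List (Row m)) {r} → r ∈ dedupFrom seen rs → r ∈ rs
  ∈-dedupFrom⁻ seen (r₀ ∷ rs) r∈ with velem (proj₁ r₀) seen
  ... | true = there (∈-dedupFrom⁻ seen rs r∈)
  ∈-dedupFrom⁻ seen (r₀ ∷ rs) (here eq)  | false = here eq
  ∈-dedupFrom⁻ seen (r₀ ∷ rs) (there r∈) | false = there (∈-dedupFrom⁻ (proj₁ r₀ ∷ seen) rs r∈)

  ∈-dedupFrom⁺ : ∀ seen (rs : List (Row m)) {r} → r ∈ rs →
                 proj₁ r ∈ seen ⊎ ∃ λ r′ → r′ ∈ dedupFrom seen rs × proj₁ r′ ≡ proj₁ r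
  ∈-dedupFrom⁺ seen (r₀ ∷ rs) r∈ with velem (proj₁ r₀) seen in eq
  ∈-dedupFrom⁺ seen (r₀ ∷ rs) (here refl) | true  = inj₁ (velem⇒∈ seen (subst T (sym eq) tt))
  ∈-dedupFrom⁺ seen (r₀ ∷ rs) (there r∈)  | true  = ∈-dedupFrom⁺ seen rs r∈
  ∈-dedupFrom⁺ seen (r₀ ∷ rs) (here refl) | false = inj₂ (r₀ , here refl , refl)
  ∈-dedupFrom⁺ seen (r₀ ∷ rs) (there r∈)  | false with ∈-dedupFrom⁺ (proj₁ r₀ ∷ seen) rs r∈
  ... | inj₁ (here eq′)             = inj₂ (r₀ , here refl , sym eq′)
  ... | inj₁ (there r∈seen)         = inj₁ r∈seen
  ... | inj₂ (r′ , r′∈ , same)      = inj₂ (r′ , there r′∈ , same)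

module KeepOnly (L : List ℕ) where

  deleted : ℕ → Bool
  deleted x = not (does (x ∈? L))

  mask : ∀ {m} → Vec ℕ m → Vec Bool m
  mask []       = []
  mask (x ∷ xs) = deleted x ∷ mask xs

  valueAt-project : ∀ {m} (as : Vec ℕ m) (v : Vec Bool m) {i} → i ∈ L →
                    valueAt (project (mask as) as) (project (mask as) v) i ≡ valueAt as v i
  valueAt-project []       []      i∈ = refl
  valueAt-project (x ∷ as) (_ ∷ v) {i} i∈ with x ∈? L
  ... | yes _ with x ≡ᵇ i
  ...   | true  = refl
  ...   | false = valueAt-project as v i∈
  valueAt-project (x ∷ as) (_ ∷ v) {i} i∈ | no x∉ with x ≡ᵇ i in x≡ᵇi
  ...   | false = valueAt-project as v i∈
  ...   | true  = contradiction (subst (_∈ L) (sym (≡ᵇ⇒≡ x i (subst T (sym x≡ᵇi) tt))) i∈) x∉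

  ∈-project⁻ : ∀ {m} (as : Vec ℕ m) {i} → i Vec.∈ project (mask as) as → i ∈ L
  ∈-project⁻ (x ∷ as) i∈ with x ∈? L
  ∈-project⁻ (x ∷ as) (vhere refl) | yes x∈ = x∈
  ∈-project⁻ (x ∷ as) (vthere i∈)  | yes _  = ∈-project⁻ as i∈
  ∈-project⁻ (x ∷ as) i∈           | no  _  = ∈-project⁻ as i∈

  ∈-project⁺ : ∀ {m} (as : Vec ℕ m) {i} → i Vec.∈ as → i ∈ L → i Vec.∈ project (mask as) as
  ∈-project⁺ (x ∷ as) i∈as i∈ with x ∈? L
  ∈-project⁺ (x ∷ as) (vhere refl) i∈ | yes _  = vhere refl
  ∈-project⁺ (x ∷ as) (vthere i∈as) i∈ | yes _ = vthere (∈-project⁺ as i∈as i∈)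
  ∈-project⁺ (x ∷ as) (vhere refl) i∈ | no x∉  = contradiction i∈ x∉
  ∈-project⁺ (x ∷ as) (vthere i∈as) i∈ | no _  = ∈-project⁺ as i∈as i∈

≤-foldr-⊔ : ∀ {x xs} → x ∈ xs → x ≤ foldr _⊔_ 0 xs
≤-foldr-⊔ {xs = y ∷ ys} (here refl) = m≤m⊔n y _
≤-foldr-⊔ {xs = y ∷ ys} (there x∈)  = ≤-trans (≤-foldr-⊔ x∈) (m≤n⊔m y _)

ψ[i]≤mψ : ∀ ψ {T i} → ¬ IsEmpty T → i Vec.∈ attrs T → ψ [ i ] ≤ mψ ψ T
ψ[i]≤mψ ψ {mkTable _ _  []}      nonEmpty _  = contradiction refl nonEmpty
ψ[i]≤mψ ψ {mkTable _ as (_ ∷ _)} _        i∈ = ≤-foldr-⊔ (∈-map⁺ (λ i → ψ [ i ]) (∈-toList⁺ i∈))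

Satisfies-transport : ∀ {n n′} {as : Vec ℕ n} {as′ : Vec ℕ n′} {v v′ i b} →
                      valueAt as v i ≡ valueAt as′ v′ i → Satisfies as v (i , b) → Satisfies as′ v′ (i , b)
Satisfies-transport eq s = valueAt⇒Satisfies (trans (sym eq) (Satisfies⇒valueAt s))

∈-nonEmpty : ∀ {A : Set} {xs : List A} → xs ≢ [] → ∃ (_∈ xs)
∈-nonEmpty {xs = []}    xs≢[] = contradiction refl xs≢[]
∈-nonEmpty {xs = x ∷ _} _     = x , here refl

module FromIrreducible {T : Table} {l₀ : ℕ × Bool} {α₀ : Word}
                       (irreducible : IrreducibleAnnihilating T (l₀ ∷ α₀)) where

  open KeepOnly (attrsOf (l₀ ∷ α₀))

  D : Vec Bool (ncols T)
  D = mask (attrs T)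

  X : Table
  X = opI T D

  open ViolationTable (attrs X) l₀ α₀ public

  rowsT′ : List (Row (ncols X))
  rowsT′ = map (λ r → proj₁ r , ν (proj₁ r)) (rows X)

  inΩ : InΩ T α
  inΩ = proj₁ (proj₁ irreducible)

  annihilated : IsEmpty (sub T α)
  annihilated = proj₁ (proj₂ (proj₁ irreducible))

  noConflict : NoConflict α
  noConflict = proj₂ (proj₂ (proj₁ irreducible))

  Satisfies-project : ∀ {v p} → Satisfies (attrs T) v (lookup α p) → Satisfies (attrs X) (project D v) (lookup α p)
  Satisfies-project {v} {p} =
    Satisfies-transport (sym (valueAt-project (attrs T) v (∈-map⁺ proj₁ (∈-lookup {xs = α} p))))

  Satisfies-project⁻ : ∀ {v p} → Satisfies (attrs X) (project D v) (lookup α p) → Satisfies (attrs T) v (lookup α p)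
  Satisfies-project⁻ {v} {p} =
    Satisfies-transport (valueAt-project (attrs T) v (∈-map⁺ proj₁ (∈-lookup {xs = α} p)))

  ∈-rowsT′⁺ : ∀ {r₀} → r₀ ∈ rows T → ∃ λ r → r ∈ rowsT′ × proj₁ r ≡ project D (proj₁ r₀)
  ∈-rowsT′⁺ r₀∈ with ∈-dedupFrom⁺ [] _ (∈-map⁺ (λ r → project D (proj₁ r) , proj₂ r) r₀∈)
  ... | inj₂ (r₁ , r₁∈ , eq) = (proj₁ r₁ , ν (proj₁ r₁)) , ∈-map⁺ (λ r → proj₁ r , ν (proj₁ r)) r₁∈ , eq

  ∈-rowsT′⁻ : ∀ {r} → r ∈ rowsT′ →
              proj₂ r ≡ ν (proj₁ r) × ∃ λ r₀ → r₀ ∈ rows T × proj₁ r ≡ project D (proj₁ r₀)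
  ∈-rowsT′⁻ r∈ with ∈-map⁻ (λ r → proj₁ r , ν (proj₁ r)) r∈
  ... | r₁ , r₁∈ , refl with ∈-map⁻ (λ r → project D (proj₁ r) , proj₂ r) (∈-dedupFrom⁻ [] _ r₁∈)
  ... | r₀ , r₀∈ , refl = refl , r₀ , r₀∈ , refl

  violates-in-T : ∀ {r₀} → r₀ ∈ rows T → ∃ λ p → ¬ Satisfies (attrs T) (proj₁ r₀) (lookup α p)
  violates-in-T {r₀} r₀∈ =
    let some = ¬All⇒Any¬ (Satisfies? (attrs T) (proj₁ r₀)) α
                 (λ sats → ∈⇒nonEmpty {sub T α} (∈-sub⁺ {T} r₀∈ sats) annihilated)
    in index some , lookup-index some

  survivor : ∀ p → ∃ λ r₀ → r₀ ∈ rows T × All (Satisfies (attrs T) (proj₁ r₀)) (removeAt α p)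
  survivor p =
    let r₀ , r₀∈ = ∈-nonEmpty (λ empty → proj₂ irreducible β (removeAt-⊑ α p) (removeAt-≢ α p) (inΩβ , empty , noConflictβ))
        r₀∈T , sats = ∈-sub⁻ {T} {β} r₀∈
    in r₀ , r₀∈T , sats
    where
    β : Word
    β = removeAt α p
    inΩβ : InΩ T β
    inΩβ = All-tabulate (λ l∈ → All-lookup inΩ (∈-removeAt⁻ α p l∈))
    noConflictβ : NoConflict β
    noConflictβ i δ σ m₁ m₂ = noConflict i δ σ (∈-removeAt⁻ α p m₁) (∈-removeAt⁻ α p m₂)

  witness-row : ∀ p → ∃ λ r → r ∈ rowsT′ × Violates (proj₁ r) p ×
                               (∀ {q} → q ≢ p → Satisfies (attrs X) (proj₁ r) (lookup α q))
  witness-row p with survivor p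
  ... | r₀ , r₀∈ , sats with ∈-rowsT′⁺ r₀∈
  ... | (_ , ds) , r∈ , refl =
    (_ , ds) , r∈ , violates , λ {q} q≢p → Satisfies-project {p = q} (All-lookup sats (∈-removeAt⁺ α q≢p))
    where
    violates : Violates (project D (proj₁ r₀)) p
    violates sat with violates-in-T r₀∈
    ... | q , viol with q ≟ᶠ p
    ... | yes refl = viol (Satisfies-project⁻ {p = p} sat)
    ... | no  q≢p  = viol (All-lookup sats (∈-removeAt⁺ α q≢p))

  isViolationTable : IsViolationTable rowsT′
  isViolationTable = record
    { decision-ν        = proj₁ ∘ ∈-rowsT′⁻
    ; violates-some     = violates-some
    ; witness           = proj₁ ∘ witness-row
    ; witness-∈         = proj₁ ∘ proj₂ ∘ witness-row
    ; witness-violates  = λ p → proj₁ (proj₂ (proj₂ (witness-row p)))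
    ; witness-satisfies = λ {p} → proj₂ (proj₂ (proj₂ (witness-row p)))
    ; attrs⊆α           = attrs⊆α
    ; α⊆attrs           = λ p → ∈-project⁺ (attrs T) (All-lookup inΩ (∈-lookup {xs = α} p))
                                                      (∈-map⁺ proj₁ (∈-lookup {xs = α} p))
    ; noConflict        = noConflict
    }
    where
    violates-some : ∀ {r} → r ∈ rowsT′ → ∃ (Violates (proj₁ r))
    violates-some {_ , _} r∈ with ∈-rowsT′⁻ r∈
    ... | _ , r₀ , r₀∈ , refl = let p , viol = violates-in-T r₀∈ in p , viol ∘ Satisfies-project⁻ {p = p}
    attrs⊆α : ∀ {i} → i Vec.∈ attrs X → ∃ λ p → attr p ≡ i
    attrs⊆α i∈ with ∈-map⁻ proj₁ (∈-project⁻ (attrs T) i∈)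
    ... | l , l∈ , refl = index l∈ , cong proj₁ (sym (lookup-index l∈))

long-irreducible⇒hard-table :
  ∀ {A : Table → Set} {ψ n T l₀ α₀} → (∀ T → InClosure A T → A T) → BoundedComplexityMeasure ψ →
  A T → mψ ψ T ≤ n → ¬ IsEmpty T → IrreducibleAnnihilating T (l₀ ∷ α₀) → n ≤ length α₀ →
  Σ ℕ λ K → (Σ Table λ T′ → A T′ × (Σ ℕ λ j → IsPsiA ψ T′ j × j ≤ n) × IsPsiD ψ T′ K) × length α₀ ≤ K
long-irreducible⇒hard-table {ψ = ψ} {n} {T} {l₀} {α₀} closed B A-T mT≤n nonEmpty irreducible n≤ =
  ψ (attrsExcept cheapest) ,
  (T′ , closed T′ (T , A-T , D , ν , ν-canonical , refl) ,
   (treeCost ψ starTree , ψᵃ-T′ (λ p → ≤-trans (attr≤n p) n≤) , treeCost-star≤ fzero (tabulate fsuc) attr≤n) ,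
   ψᵈ-T′) ,
  length≤ψ-attrsExcept cheapest
  where
  open FromIrreducible {T} {l₀} {α₀} irreducible
  open Complexity B isViolationTable
  attr≤n : ∀ p → ψ [ attr p ] ≤ n
  attr≤n p = ≤-trans (ψ[i]≤mψ ψ nonEmpty (All-lookup inΩ (∈-lookup {xs = α} p))) mT≤n

IsG⇒irreducible : ∀ {T g} → IsG T g → 0 < g →
                  ¬ IsEmpty T × ∃ λ α → IrreducibleAnnihilating T α × length α ≡ g
IsG⇒irreducible (inj₁ (_ , refl))                               ()
IsG⇒irreducible (inj₂ (_ , inj₁ (_ , refl)))                    ()
IsG⇒irreducible (inj₂ (nonEmpty , inj₂ ((α , irr , len) , _))) _ = nonEmpty , α , irr , len

lemma14 : (A : Table → Set) → IsClass A → Closed A → Nontrivial A →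
          (ψ : List ℕ → ℕ) → BoundedComplexityMeasure ψ →
          Σ ℕ (λ n → GUndefined ψ A n) → Σ ℕ (λ n → HUndefined ψ A n)
lemma14 A _ (closed , _) _ ψ B (n , G-undefined) = n , λ M → hard M (G-undefined (suc (M ⊔ n)))
  where
  hard : ∀ M → (Σ ℕ λ g → (Σ Table λ T → (A T × mψ ψ T ≤ n) × IsG T g) × suc (M ⊔ n) ≤ g) →
         Σ ℕ λ K → (Σ Table λ T → A T × (Σ ℕ λ j → IsPsiA ψ T j × j ≤ n) × IsPsiD ψ T K) × M ≤ K
  hard M (g , (T , (A-T , mT≤n) , isG) , M⊔n<g) with IsG⇒irreducible isG (≤-trans (s≤s z≤n) M⊔n<g)
  ... | _        , []      , _           , refl = contradiction M⊔n<g λ ()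
  ... | nonEmpty , _ ∷ α₀ , irreducible , refl =
    let M⊔n≤ = ≤-pred M⊔n<g
        K , hard-table , α₀≤K = long-irreducible⇒hard-table closed B A-T mT≤n nonEmpty irreducible
                                                             (≤-trans (m≤n⊔m M n) M⊔n≤)
    in K , hard-table , ≤-trans (m≤m⊔n M n) (≤-trans M⊔n≤ α₀≤K)
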